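{- Let $T$ be a binary unrooted phylogenetic tree of order $n\geq 4$ and let $T_1,\dots,T_k$ be $k$ rootings of $T$. If $n>k^2-6$, then there exists a triplet in $\mathcal{T}_n$ that is not displayed by any of $T_1,\dots,T_k$.
   Context: A binary unrooted phylogenetic tree of order $n$ is a tree in which every internal vertex has degree 3 and which has $n$ leaves bijectively labelled by $\{1,\dots,n\}$. A binary rooted phylogenetic tree of order $n$ is a rooted tree, edges directed away from the root, root of out-degree 2, other internal vertices of in-degree 1 and out-degree 2, with $n$ leaves bijectively labelled by $\{1,\dots,n\}$. A rooting of $T$ is a binary rooted phylogenetic tree obtained from $T$ by subdividing an edge $e$ with a new vertex $\rho$, taken as the root, and directing all edges away from $\rho$. A rooted tree $T'$ displays the triplet $ab|c$ if $\mathrm{lca}_{T'}(a,c)=\mathrm{lca}_{T'}(b,c)$ is a proper ancestor of $\mathrm{lca}_{T'}(a,b)$. $\mathcal{T}_n=\{ab|c: a,b,c\in\{1,\dots,n\}\text{ pairwise distinct}\}$, where $ab|c=ba|c$. -}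

module Defs where

open import Data.Nat using (ℕ; zero; suc)
open import Data.Fin using (Fin)
open import Data.Bool using (Bool; true; false; T)
open import Data.Maybe using (Maybe; just; nothing)
open import Data.List using (List; []; _∷_; length; filterᵇ)
open import Data.List.Base using (allFin)
open import Data.List.Relation.Unary.Unique.Propositional using (Unique)
open import Data.List.Membership.Propositional using (_∈_)
open import Data.Product using (Σ; Σ-syntax; ∃; _×_)
open import Data.Sum using (_⊎_)
open import Data.Empty using (⊥)
open import Relation.Nullary using (¬_)
open import Relation.Binary.PropositionalEquality using (_≡_; _≢_)
open import Function.Definitions using (Injective)

data Walk {V : Set} (E : V → V → Set) : V → V → Set where
  [] : ∀ {u} → Walk E u u
  _∷_ : ∀ {u w v} → E u w → Walk E w v → Walk E u v

vertices : ∀ {V : Set} {E : V → V → Set} {u v : V} → Walk E u v → List V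
vertices {u = u} [] = u ∷ []
vertices {u = u} (_ ∷ p) = u ∷ vertices p

SimplePath : ∀ {V : Set} (E : V → V → Set) → V → V → Set
SimplePath E u v = Σ (Walk E u v) (λ p → Unique (vertices p))

record UTree (n : ℕ) : Set where
  field
    m        : ℕ
    adj      : Fin m → Fin m → Bool
    adj-sym  : ∀ u v → adj u v ≡ adj v u
    adj-irr  : ∀ u → adj u u ≡ false
    path-exists : ∀ u v → SimplePath (λ x y → T (adj x y)) u v
    path-unique : ∀ u v (p q : SimplePath (λ x y → T (adj x y)) u v) →
                  vertices (Σ.proj₁ p) ≡ vertices (Σ.proj₁ q)
  Edge : Fin m → Fin m → Set
  Edge u v = T (adj u v)
  deg : Fin m → ℕ
  deg v = length (filterᵇ (adj v) (allFin m))
  field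
    deg-1-or-3 : ∀ v → deg v ≡ 1 ⊎ deg v ≡ 3
    leaf      : Fin n → Fin m
    leaf-inj  : Injective _≡_ _≡_ leaf
    leaf-deg  : ∀ i → deg (leaf i) ≡ 1
    leaf-surj : ∀ v → deg v ≡ 1 → ∃ λ i → leaf i ≡ v

-- Rootings: subdivide an edge {u,v} of T with a new vertex ρ (= nothing)

record Rooting {n : ℕ} (T' : UTree n) : Set where
  open UTree T'
  field
    u v : Fin m
    uv  : Edge u v

module _ {n : ℕ} {T' : UTree n} (R : Rooting T') where
  open UTree T'
  open Rooting R

  RV : Set
  RV = Maybe (Fin m)

  ρ : RV
  ρ = nothing

  RAdj : RV → RV → Set
  RAdj nothing nothing = ⊥
  RAdj nothing (just w) = w ≡ u ⊎ w ≡ v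
  RAdj (just w) nothing = w ≡ u ⊎ w ≡ v
  RAdj (just a) (just b) = Edge a b × ¬ ((a ≡ u × b ≡ v) ⊎ (a ≡ v × b ≡ u))

  Anc : RV → RV → Set
  Anc x y = Σ (SimplePath RAdj ρ y) (λ p → x ∈ vertices (Σ.proj₁ p))

  ProperAnc : RV → RV → Set
  ProperAnc x y = Anc x y × x ≢ y

  IsLCA : RV → RV → RV → Set
  IsLCA w a b = Anc w a × Anc w b × (∀ z → Anc z a → Anc z b → Anc z w)

  Displays : Fin n → Fin n → Fin n → Set
  Displays a b c =
    Σ[ w ∈ RV ] Σ[ z ∈ RV ]
      IsLCA w (just (leaf a)) (just (leaf c)) ×
      IsLCA w (just (leaf b)) (just (leaf c)) ×
      IsLCA z (just (leaf a)) (just (leaf b)) ×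
      ProperAnc w z

module Submission where

-- Since n ≥ 4 and k² < n + 6 we have k < n.  The edge subdivided by a rooting joins at most
-- one leaf (two adjacent leaves would be the whole tree), so by pigeonhole some leaf c is an
-- end of none of the k subdivided edges.  Let h be the neighbour of c; it is internal, so it
-- has two further neighbours x ≢ y, and walking away from h through x (resp. y) reaches
-- leaves a (resp. b).  In any rooting, h is the parent of c.  If ab|c were displayed with
-- w = lca(a,c) = lca(b,c) strictly above z = lca(a,b), then either h is an ancestor of a
-- (or b), hence of w and z, strictly above z, and the root paths to a and b would leave h
-- through the same child - yet they leave through x and y; or both root paths avoid h, and
-- then T would contain a walk from x to b avoiding h, contradicting that the path from h to
-- b starts h, y.

open import Defs
open import Data.Nat using (ℕ; zero; suc; _*_; _+_; _≤_; _<_; s≤s; _≤?_)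
open import Data.Nat.Properties
  using (≤-trans; m≤m+n; n≤1+n; +-identityʳ; +-assoc; +-monoʳ-≤; *-monoʳ-≤; *-monoˡ-≤; *-mono-≤; <⇒≱; ≰⇒>; module ≤-Reasoning)
open import Data.Fin using (Fin) renaming (zero to fz; suc to fs)
open import Data.Fin.Properties using (pigeonhole; any?; all?) renaming (_≟_ to _≟F_; <⇒≢ to <⇒≢F)
open import Data.Bool using (T)
open import Data.Bool.Properties using (T?)
open import Data.Maybe using (Maybe; just; nothing)
open import Data.Maybe.Properties using (just-injective) renaming (≡-dec to ≡-decMaybe)
open import Data.List using (List; []; _∷_; _++_; _∷ʳ_; length; map; filterᵇ; lookup; head)
open import Data.List.Base using (allFin)
open import Data.List.Properties using (++-assoc; ∷-injectiveˡ; ∷-injectiveʳ; ∷ʳ-injective; ∷ʳ-injectiveˡ; length-++)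
open import Data.List.Relation.Unary.Any using (here; there)
open import Data.List.Relation.Unary.All using ([]; _∷_)
open import Data.List.Relation.Unary.All.Properties using (¬Any⇒All¬; All¬⇒¬Any; ++⁺; ++⁻ˡ; ++⁻ʳ)
open import Data.List.Relation.Unary.AllPairs using ([]; _∷_)
open import Data.List.Relation.Unary.Unique.Propositional using (Unique)
import Data.List.Relation.Unary.Unique.Propositional.Properties as UniqueProps
open UniqueProps using (Unique[x∷xs]⇒x∉xs)
open import Data.List.Membership.Propositional using (_∈_; _∉_)
open import Data.List.Membership.Propositional.Properties
  using (∈-lookup; ∈-filter⁺; ∈-filter⁻; ∈-allFin; ∈-++⁺ˡ; ∈-++⁺ʳ; ∈-++⁻; ∈-map⁺)
open import Data.Product using (Σ; Σ-syntax; ∃; _×_; _,_; proj₁; proj₂)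
open import Data.Sum using (_⊎_; inj₁; inj₂)
open import Data.Empty using (⊥; ⊥-elim)
open import Relation.Nullary using (¬_; Dec; yes; no; contradiction)
open import Relation.Nullary.Decidable using (_⊎-dec_; ¬?)
open import Relation.Binary.Definitions using (DecidableEquality)
open import Relation.Binary.PropositionalEquality
  using (_≡_; _≢_; refl; sym; trans; cong; cong₂; subst; subst₂; module ≡-Reasoning)
open import Function using (_∘_)

module UniqueLists {A : Set} where

  unique-tail : ∀ {x : A} {xs} → Unique (x ∷ xs) → Unique xs
  unique-tail (_ ∷ u) = u

  unique-∷ : ∀ {x : A} {xs} → x ∉ xs → Unique xs → Unique (x ∷ xs)
  unique-∷ x∉ u = ¬Any⇒All¬ _ x∉ ∷ u

  unique-∷ʳ : ∀ (xs : List A) {x} → Unique xs → x ∉ xs → Unique (xs ∷ʳ x)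
  unique-∷ʳ []       _          _  = [] ∷ []
  unique-∷ʳ (y ∷ xs) (y∉ ∷ u)  x∉ =
    ++⁺ y∉ ((λ y≡x → x∉ (here (sym y≡x))) ∷ []) ∷ unique-∷ʳ xs u (x∉ ∘ there)

  unique-++ˡ : ∀ (xs : List A) {ys} → Unique (xs ++ ys) → Unique xs
  unique-++ˡ []       _          = []
  unique-++ˡ (_ ∷ xs) (x∉ ∷ u)  = ++⁻ˡ xs x∉ ∷ unique-++ˡ xs u

  unique-++ʳ : ∀ (xs : List A) {ys} → Unique (xs ++ ys) → Unique ys
  unique-++ʳ []       u       = u
  unique-++ʳ (_ ∷ xs) (_ ∷ u) = unique-++ʳ xs u

  unique-disjoint : ∀ (xs : List A) {ys z} → Unique (xs ++ ys) → z ∈ xs → z ∉ ys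
  unique-disjoint (_ ∷ xs) (x∉ ∷ _) (here refl) = All¬⇒¬Any (++⁻ʳ xs x∉)
  unique-disjoint (_ ∷ xs) (_ ∷ u)  (there z∈)  = unique-disjoint xs u z∈

  lookup-injective : ∀ (xs : List A) → Unique xs → ∀ {i j} → lookup xs i ≡ lookup xs j → i ≡ j
  lookup-injective (_ ∷ xs) u {fz}   {fz}   _  = refl
  lookup-injective (_ ∷ xs) u {fz}   {fs j} eq = contradiction (subst (_∈ xs) (sym eq) (∈-lookup j)) (Unique[x∷xs]⇒x∉xs u)
  lookup-injective (_ ∷ xs) u {fs i} {fz}   eq = contradiction (subst (_∈ xs) eq (∈-lookup i)) (Unique[x∷xs]⇒x∉xs u)
  lookup-injective (_ ∷ xs) u {fs i} {fs j} eq = cong fs (lookup-injective xs (unique-tail u) eq)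

  penultimate-unique : ∀ (xs ys : List A) {a b c d} → xs ++ a ∷ b ∷ [] ≡ ys ++ c ∷ d ∷ [] → a ≡ c
  penultimate-unique xs ys {a} {b} {c} {d} eq =
    proj₂ (∷ʳ-injective xs ys (proj₁ (∷ʳ-injective (xs ∷ʳ a) (ys ∷ʳ c) reassociated)))
    where
      reassociated : (xs ∷ʳ a) ∷ʳ b ≡ (ys ∷ʳ c) ∷ʳ d
      reassociated = trans (++-assoc xs (a ∷ []) (b ∷ [])) (trans eq (sym (++-assoc ys (c ∷ []) (d ∷ []))))

open UniqueLists

unique-length : ∀ {m} (xs : List (Fin m)) → Unique xs → length xs ≤ m
unique-length {m} xs u with length xs ≤? m
... | yes ≤m = ≤m
... | no ≰m with pigeonhole (≰⇒> ≰m) (lookup xs)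
...   | i , j , i<j , eq = contradiction (lookup-injective xs u eq) (<⇒≢F i<j)

module DecidableLists {A : Set} (_≟_ : DecidableEquality A) where

  singleton-members : ∀ (xs : List A) {x y} → length xs ≡ 1 → x ∈ xs → y ∈ xs → x ≡ y
  singleton-members (_ ∷ []) _ (here refl) (here refl) = refl

  singleton-member : ∀ (xs : List A) → length xs ≡ 1 → ∃ λ x → x ∈ xs
  singleton-member (x ∷ []) _ = x , here refl

  two-avoiding : ∀ (xs : List A) → length xs ≡ 3 → Unique xs → ∀ c →
                 Σ A λ x → Σ A λ y → x ∈ xs × y ∈ xs × x ≢ y × x ≢ c × y ≢ c
  two-avoiding (t₁ ∷ t₂ ∷ t₃ ∷ []) _ ((t₁≢t₂ ∷ t₁≢t₃ ∷ []) ∷ (t₂≢t₃ ∷ []) ∷ _) c with t₁ ≟ c | t₂ ≟ c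
  ... | yes refl | _        = t₂ , t₃ , there (here refl) , there (there (here refl)) , t₂≢t₃ , t₁≢t₂ ∘ sym , t₁≢t₃ ∘ sym
  ... | no t₁≢c  | yes refl = t₁ , t₃ , here refl , there (there (here refl)) , t₁≢t₃ , t₁≢t₂ , t₂≢t₃ ∘ sym
  ... | no t₁≢c  | no t₂≢c  = t₁ , t₂ , here refl , there (here refl) , t₁≢t₂ , t₁≢c , t₂≢c

  avoid-two : ∀ {x y z : A} → x ≢ y → x ≢ z → y ≢ z → ∀ a b → ∃ λ w → w ≢ a × w ≢ b
  avoid-two {x} {y} {z} x≢y x≢z y≢z a b with x ≟ a | x ≟ b | y ≟ a | y ≟ b
  ... | no x≢a   | no x≢b   | _        | _        = x , x≢a , x≢b
  ... | _        | _        | no y≢a   | no y≢b   = y , y≢a , y≢b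
  ... | yes refl | _        | _        | yes refl = z , x≢z ∘ sym , y≢z ∘ sym
  ... | _        | yes refl | yes refl | _        = z , y≢z ∘ sym , x≢z ∘ sym
  ... | yes refl | _        | yes refl | _        = contradiction refl x≢y
  ... | _        | yes refl | _        | yes refl = contradiction refl x≢y

  next : A → List A → Maybe A
  next x []       = nothing
  next x (y ∷ ys) with x ≟ y
  ... | yes _ = head ys
  ... | no  _ = next x ys

  next-first : ∀ x pre z rest → x ∉ pre → next x (pre ++ x ∷ z ∷ rest) ≡ just z
  next-first x []        z rest _  with x ≟ x
  ... | yes _ = refl
  ... | no  x≢x = contradiction refl x≢x
  next-first x (y ∷ pre) z rest x∉ with x ≟ y
  ... | yes x≡y = contradiction (here x≡y) x∉
  ... | no  _   = next-first x pre z rest (x∉ ∘ there)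

  next-prefix : ∀ x pre z ys zs → x ∈ pre → next x (pre ++ z ∷ ys) ≡ next x (pre ++ z ∷ zs)
  next-prefix x (y ∷ pre) z ys zs x∈ with x ≟ y
  next-prefix x (y ∷ [])      z ys zs x∈ | yes _ = refl
  next-prefix x (y ∷ w ∷ pre) z ys zs x∈ | yes _ = refl
  next-prefix x (y ∷ pre) z ys zs (here x≡y) | no x≢y = contradiction x≡y x≢y
  next-prefix x (y ∷ pre) z ys zs (there x∈) | no _   = next-prefix x pre z ys zs x∈

module Walks {V : Set} (E : V → V → Set) where

  first∈ : ∀ {s e} (p : Walk E s e) → s ∈ vertices p
  first∈ []      = here refl
  first∈ (_ ∷ _) = here refl

  last∈ : ∀ {s e} (p : Walk E s e) → e ∈ vertices p
  last∈ []      = here refl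
  last∈ (_ ∷ p) = there (last∈ p)

  vertices-start : ∀ {s e} (p : Walk E s e) → ∃ λ rest → vertices p ≡ s ∷ rest
  vertices-start []      = [] , refl
  vertices-start (_ ∷ p) = vertices p , refl

  same-start : ∀ {s e s′ e′} (p : Walk E s e) (q : Walk E s′ e′) → vertices p ≡ vertices q → s ≡ s′
  same-start p q eq = ∷-injectiveˡ (trans (sym (proj₂ (vertices-start p))) (trans eq (proj₂ (vertices-start q))))

  first-edge : ∀ {a b e rest} (p : Walk E a e) → vertices p ≡ a ∷ b ∷ rest → E a b
  first-edge (f ∷ p) eq =
    subst (E _) (∷-injectiveˡ (trans (sym (proj₂ (vertices-start p))) (∷-injectiveʳ eq))) f

  last-edge : ∀ {s e} (p : Walk E s e) → s ≢ e → ∃ λ t → E t e × t ∈ vertices p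
  last-edge []      s≢e = contradiction refl s≢e
  last-edge (f ∷ p) _   = entering f p
    where
      entering : ∀ {s w e} (g : E s w) (p : Walk E w e) → ∃ λ t → E t e × t ∈ vertices (g ∷ p)
      entering {s} g []      = s , g , here refl
      entering     _ (g ∷ p) with entering g p
      ... | t , t→e , t∈ = t , t→e , there t∈

  infixr 5 _++ᵂ_
  _++ᵂ_ : ∀ {a b c} → Walk E a b → Walk E b c → Walk E a c
  []      ++ᵂ q = q
  (f ∷ p) ++ᵂ q = f ∷ (p ++ᵂ q)

  ∈-++ᵂ : ∀ {a b c x} (p : Walk E a b) (q : Walk E b c) →
          x ∈ vertices (p ++ᵂ q) → x ∈ vertices p ⊎ x ∈ vertices q
  ∈-++ᵂ []      q x∈          = inj₂ x∈
  ∈-++ᵂ (_ ∷ p) q (here refl) = inj₁ (here refl)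
  ∈-++ᵂ (_ ∷ p) q (there x∈) with ∈-++ᵂ p q x∈
  ... | inj₁ x∈p = inj₁ (there x∈p)
  ... | inj₂ x∈q = inj₂ x∈q

  vertices-snoc : ∀ {a b c} (p : Walk E a b) (f : E b c) → vertices (p ++ᵂ f ∷ []) ≡ vertices p ∷ʳ c
  vertices-snoc     []      f = refl
  vertices-snoc {a} (g ∷ p) f = cong (a ∷_) (vertices-snoc p f)

  module Reversal (E-sym : ∀ {a b} → E a b → E b a) where

    reverseᵂ : ∀ {a b} → Walk E a b → Walk E b a
    reverseᵂ []      = []
    reverseᵂ (f ∷ p) = reverseᵂ p ++ᵂ E-sym f ∷ []

    ∈-reverseᵂ : ∀ {a b x} (p : Walk E a b) → x ∈ vertices (reverseᵂ p) → x ∈ vertices p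
    ∈-reverseᵂ []      x∈ = x∈
    ∈-reverseᵂ (f ∷ p) x∈ with ∈-++ᵂ (reverseᵂ p) (E-sym f ∷ []) x∈
    ... | inj₁ x∈p                 = there (∈-reverseᵂ p x∈p)
    ... | inj₂ (here refl)         = there (first∈ p)
    ... | inj₂ (there (here refl)) = here refl

module SimpleWalks {V : Set} (_≟_ : DecidableEquality V) (E : V → V → Set) where
  open Walks E
  open import Data.List.Membership.DecPropositional _≟_ public using (_∈?_)

  record Split {s e} (p : Walk E s e) (t : V) : Set where
    field
      pre             : List V
      before          : Walk E s t
      after           : Walk E t e
      vertices-split  : vertices p ≡ pre ++ vertices after
      vertices-before : vertices before ≡ pre ∷ʳ t
      t∉pre           : t ∉ pre

  split : ∀ {s e} (p : Walk E s e) t → t ∈ vertices p → Split p t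
  split {s} p t t∈ with s ≟ t
  ... | yes refl = record { pre = [] ; before = [] ; after = p ; vertices-split = refl
                          ; vertices-before = refl ; t∉pre = λ () }
  split []      t (here t≡s) | no s≢t = contradiction (sym t≡s) s≢t
  split (f ∷ p) t (here t≡s) | no s≢t = contradiction (sym t≡s) s≢t
  split {s} (f ∷ p) t (there t∈) | no s≢t =
    record { pre = s ∷ pre ; before = f ∷ before ; after = after
           ; vertices-split = cong (s ∷_) vertices-split
           ; vertices-before = cong (s ∷_) vertices-before
           ; t∉pre = λ { (here t≡s) → s≢t (sym t≡s) ; (there t∈pre) → t∉pre t∈pre } }
    where open Split (split p t t∈)

  module _ {s e t} {p : Walk E s e} (S : Split p t) (simple : Unique (vertices p)) where
    open Split S

    after-unique : Unique (vertices after)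
    after-unique = unique-++ʳ pre (subst Unique vertices-split simple)

    private
      regrouped : vertices p ≡ vertices before ++ proj₁ (vertices-start after)
      regrouped = let open ≡-Reasoning; rest , eq = vertices-start after in begin
        vertices p                 ≡⟨ vertices-split ⟩
        pre ++ vertices after      ≡⟨ cong (pre ++_) eq ⟩
        pre ++ t ∷ rest            ≡⟨ sym (++-assoc pre (t ∷ []) rest) ⟩
        (pre ∷ʳ t) ++ rest         ≡⟨ cong (_++ rest) (sym vertices-before) ⟩
        vertices before ++ rest    ∎

    before-unique : Unique (vertices before)
    before-unique = unique-++ˡ (vertices before) (subst Unique regrouped simple)

    before-⊆ : ∀ {x} → x ∈ vertices before → x ∈ vertices p
    before-⊆ x∈ = subst (_ ∈_) (sym regrouped) (∈-++⁺ˡ x∈)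

  simplify : ∀ {s e} (p : Walk E s e) →
             Σ (Walk E s e) λ q → Unique (vertices q) × (∀ {x} → x ∈ vertices q → x ∈ vertices p)
  simplify []  = [] , [] ∷ [] , λ x∈ → x∈
  simplify {s} (f ∷ p) with simplify p
  ... | q , uq , q⊆p with s ∈? vertices q
  ... | no s∉q = f ∷ q , unique-∷ s∉q uq , λ { (here refl) → here refl ; (there x∈) → there (q⊆p x∈) }
  ... | yes s∈q = after , after-unique S uq , λ x∈ → there (q⊆p (subst (_ ∈_) (sym vertices-split) (∈-++⁺ʳ pre x∈)))
    where
      S = split q s s∈q
      open Split S

module Trees {n : ℕ} (T' : UTree n) where
  open UTree T'
  open DecidableLists (_≟F_ {m}) using (singleton-members; singleton-member; two-avoiding)

  edge-sym : ∀ {a b} → Edge a b → Edge b a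
  edge-sym {a} {b} = subst T (adj-sym a b)

  edge-distinct : ∀ {a b} → Edge a b → a ≢ b
  edge-distinct {a} e refl = subst T (adj-irr a) e

  edge-unique : ∀ {a b} → Edge a b → Unique (a ∷ b ∷ [])
  edge-unique e = (edge-distinct e ∷ []) ∷ [] ∷ []

  open Walks Edge public
  open Reversal edge-sym public
  open SimpleWalks _≟F_ Edge public

  paths-agree : ∀ {s t} (p q : Walk Edge s t) → Unique (vertices p) → Unique (vertices q) →
                vertices p ≡ vertices q
  paths-agree p q up uq = path-unique _ _ (p , up) (q , uq)

  edge-path : ∀ {a b} → Edge a b → (p : Walk Edge a b) → Unique (vertices p) → vertices p ≡ a ∷ b ∷ []
  edge-path e p up = paths-agree p (e ∷ []) up (edge-unique e)

  neighbours : Fin m → List (Fin m)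
  neighbours v = filterᵇ (adj v) (allFin m)

  neighbour⁺ : ∀ {v t} → Edge v t → t ∈ neighbours v
  neighbour⁺ {v} {t} = ∈-filter⁺ (T? ∘ adj v) (∈-allFin t)

  neighbour⁻ : ∀ {v t} → t ∈ neighbours v → Edge v t
  neighbour⁻ {v} t∈ = proj₂ (∈-filter⁻ (T? ∘ adj v) {xs = allFin m} t∈)

  neighbours-unique : ∀ v → Unique (neighbours v)
  neighbours-unique v = UniqueProps.filter⁺ (T? ∘ adj v) (UniqueProps.allFin⁺ m)

  leaf-neighbour : ∀ {v} → deg v ≡ 1 → ∃ λ t → Edge v t
  leaf-neighbour {v} d with singleton-member (neighbours v) d
  ... | t , t∈ = t , neighbour⁻ t∈

  leaf-neighbour-unique : ∀ {v t t′} → deg v ≡ 1 → Edge v t → Edge v t′ → t ≡ t′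
  leaf-neighbour-unique {v} d e e′ = singleton-members (neighbours v) d (neighbour⁺ e) (neighbour⁺ e′)

  two-other-neighbours : ∀ {v} → deg v ≡ 3 → ∀ c →
                         Σ (Fin m) λ x → Σ (Fin m) λ y → Edge v x × Edge v y × x ≢ y × x ≢ c × y ≢ c
  two-other-neighbours {v} d c with two-avoiding (neighbours v) d (neighbours-unique v) c
  ... | x , y , x∈ , y∈ , rest = x , y , neighbour⁻ x∈ , neighbour⁻ y∈ , rest

  -- two adjacent leaves form the whole tree: a path from one of them to a third vertex
  -- would have to return to its start
  adjacent-leaves : ∀ {a b ℓ} → deg a ≡ 1 → deg b ≡ 1 → Edge a b → ℓ ≢ a → ℓ ≢ b → ⊥
  adjacent-leaves {a} {b} {ℓ} da db ab ℓ≢a ℓ≢b with path-exists a ℓ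
  ... | [] , _ = ℓ≢a refl
  ... | f ∷ p , u with leaf-neighbour-unique da ab f
  ... | refl with p
  ...   | []     = ℓ≢b refl
  ...   | g ∷ p′ with leaf-neighbour-unique db (edge-sym ab) g
  ...     | refl = Unique[x∷xs]⇒x∉xs u (there (first∈ p′))

  edge-side : ∀ {a b y} → Edge a b → (P : Walk Edge a y) (Q : Walk Edge b y) →
              Unique (vertices P) → Unique (vertices Q) →
              (∃ λ rest → vertices P ≡ a ∷ b ∷ rest) ⊎ (∃ λ rest → vertices Q ≡ b ∷ a ∷ rest)
  edge-side {a} {b} ab P Q uP uQ with b ∈? vertices P
  ... | no b∉P = let rest , eq = vertices-start P in
    inj₂ (rest , trans (paths-agree Q (edge-sym ab ∷ P) uQ (unique-∷ b∉P uP)) (cong (b ∷_) eq))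
  ... | yes b∈P = inj₁ (rest , through-b)
    where
      S = split P b b∈P
      open Split S
      rest = proj₁ (vertices-start after)
      pre≡a : pre ≡ a ∷ []
      pre≡a = ∷ʳ-injectiveˡ pre (a ∷ []) (trans (sym vertices-before) (edge-path ab before (before-unique S uP)))
      through-b : vertices P ≡ a ∷ b ∷ rest
      through-b = let open ≡-Reasoning in begin
        vertices P             ≡⟨ vertices-split ⟩
        pre ++ vertices after  ≡⟨ cong₂ _++_ pre≡a (proj₂ (vertices-start after)) ⟩
        a ∷ b ∷ rest           ∎

  record Branch (h x t : Fin m) : Set where
    field
      first  : Edge h x
      rest   : Walk Edge x t
      simple : Unique (h ∷ vertices rest)

    path : Walk Edge h t
    path = first ∷ rest

  branch-unique : ∀ {h x y t} → Branch h x t → Branch h y t → x ≡ y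
  branch-unique A B =
    same-start (Branch.rest A) (Branch.rest B)
               (∷-injectiveʳ (paths-agree (Branch.path A) (Branch.path B) (Branch.simple A) (Branch.simple B)))

  branch-from-walk : ∀ {h x t} → Edge h x → (w : Walk Edge x t) → h ∉ vertices w → Branch h x t
  branch-from-walk hx w h∉w with simplify w
  ... | s , us , s⊆w = record { first = hx ; rest = s ; simple = unique-∷ (h∉w ∘ s⊆w) us }

  LeafBeyond : Fin m → Fin m → Set
  LeafBeyond h x = Σ (Fin n) λ a → Branch h x (leaf a)

  fresh-neighbour : ∀ {s e} (w : Walk Edge s e) → Unique (vertices w) →
                    ∀ ys p → vertices w ≡ ys ++ p ∷ e ∷ [] → deg e ≡ 3 →
                    ∃ λ t → Edge e t × t ∉ vertices w
  fresh-neighbour {e = e} w uw ys p ends d with two-other-neighbours d p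
  ... | t , _ , et , _ , _ , t≢p , _ with t ∈? vertices w
  ... | no t∉w = t , et , t∉w
  ... | yes t∈w = contradiction (penultimate-unique pre ys (trans (sym closes) ends)) t≢p
    where
      S = split w t t∈w
      open Split S
      -- otherwise w would end t, e as well
      closes : vertices w ≡ pre ++ t ∷ e ∷ []
      closes = trans vertices-split (cong (pre ++_) (edge-path (edge-sym et) after (after-unique S uw)))

  -- prolong a simple walk h, x, …, p, e until it reaches a leaf; it has at most m vertices,
  -- so fuel with m < length + fuel suffices
  extend-to-leaf : ∀ {h x e} (hx : Edge h x) (q : Walk Edge x e) (fuel : ℕ) →
                   m < length (vertices (hx ∷ q)) + fuel → Unique (vertices (hx ∷ q)) →
                   ∀ ys p → vertices (hx ∷ q) ≡ ys ++ p ∷ e ∷ [] → LeafBeyond h x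
  extend-to-leaf {e = e} hx q fuel bound u ys p ends with deg-1-or-3 e
  ... | inj₁ d1 with leaf-surj e d1
  ...   | a , refl = a , record { first = hx ; rest = q ; simple = u }
  extend-to-leaf hx q zero bound u ys p ends | inj₂ _ =
    contradiction (unique-length _ u) (<⇒≱ (subst (m <_) (+-identityʳ _) bound))
  extend-to-leaf {e = e} hx q (suc fuel) bound u ys p ends | inj₂ d3
    with fresh-neighbour (hx ∷ q) u ys p ends d3
  ... | t , et , t∉ = extend-to-leaf hx (q ++ᵂ et ∷ []) fuel bound′ u′ (ys ∷ʳ p) e ends′
    where
      open ≡-Reasoning
      L = vertices (hx ∷ q)
      grown : vertices (hx ∷ (q ++ᵂ et ∷ [])) ≡ L ∷ʳ t
      grown = vertices-snoc (hx ∷ q) et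
      bound′ : m < length (vertices (hx ∷ (q ++ᵂ et ∷ []))) + fuel
      bound′ = subst (λ k → m < k + fuel) (sym (trans (cong length grown) (length-++ L)))
                     (subst (m <_) (sym (+-assoc (length L) 1 fuel)) bound)
      u′ : Unique (vertices (hx ∷ (q ++ᵂ et ∷ [])))
      u′ = subst Unique (sym grown) (unique-∷ʳ L u t∉)
      ends′ : vertices (hx ∷ (q ++ᵂ et ∷ [])) ≡ (ys ∷ʳ p) ++ e ∷ t ∷ []
      ends′ = begin
        vertices (hx ∷ (q ++ᵂ et ∷ []))  ≡⟨ grown ⟩
        L ∷ʳ t                          ≡⟨ cong (_∷ʳ t) ends ⟩
        (ys ++ p ∷ e ∷ []) ∷ʳ t         ≡⟨ ++-assoc ys (p ∷ e ∷ []) (t ∷ []) ⟩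
        ys ++ p ∷ e ∷ t ∷ []            ≡⟨ sym (++-assoc ys (p ∷ []) (e ∷ t ∷ [])) ⟩
        (ys ∷ʳ p) ++ e ∷ t ∷ []         ∎

  leaf-beyond : ∀ {h x} → Edge h x → LeafBeyond h x
  leaf-beyond {h} hx = extend-to-leaf hx [] m (s≤s (n≤1+n m)) (edge-unique hx) [] h refl

module RootedTrees {n : ℕ} {T' : UTree n} (R : Rooting T') where
  open UTree T'
  open Rooting R
  open Trees T'

  _≟ᴿ_ : DecidableEquality (RV R)
  _≟ᴿ_ = ≡-decMaybe _≟F_

  module RW = Walks (RAdj R)
  module RS = SimpleWalks _≟ᴿ_ (RAdj R)
  open DecidableLists _≟ᴿ_ using (next; next-first; next-prefix)

  RootPath : RV R → Set
  RootPath = Walk (RAdj R) nothing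

  IsRootEdge : Fin m → Fin m → Set
  IsRootEdge a b = (a ≡ u × b ≡ v) ⊎ (a ≡ v × b ≡ u)

  root-edge : ∀ {a b} → IsRootEdge a b → Edge a b
  root-edge (inj₁ (refl , refl)) = uv
  root-edge (inj₂ (refl , refl)) = edge-sym uv

  root-edge-sym : ∀ {a b} → IsRootEdge a b → IsRootEdge b a
  root-edge-sym (inj₁ (a≡u , b≡v)) = inj₂ (b≡v , a≡u)
  root-edge-sym (inj₂ (a≡v , b≡u)) = inj₁ (b≡u , a≡v)

  root-children : ∀ {s s′} → (s ≡ u ⊎ s ≡ v) → (s′ ≡ u ⊎ s′ ≡ v) → s ≢ s′ → IsRootEdge s s′
  root-children (inj₁ refl) (inj₁ refl) s≢s′ = contradiction refl s≢s′
  root-children (inj₂ refl) (inj₂ refl) s≢s′ = contradiction refl s≢s′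
  root-children (inj₁ s≡u)  (inj₂ s′≡v) _    = inj₁ (s≡u , s′≡v)
  root-children (inj₂ s≡v)  (inj₁ s′≡u) _    = inj₂ (s≡v , s′≡u)

  root-bridge : ∀ {s s′} → (s ≡ u ⊎ s ≡ v) → (s′ ≡ u ⊎ s′ ≡ v) →
                Σ (Walk Edge s s′) λ C → ∀ {t} → t ∈ vertices C → t ≡ s ⊎ t ≡ s′
  root-bridge {s} {s′} s-child s′-child with s ≟F s′
  ... | yes refl = [] , λ { (here t≡s) → inj₁ t≡s }
  ... | no s≢s′  = root-edge (root-children s-child s′-child s≢s′) ∷ [] ,
                   λ { (here t≡s) → inj₁ t≡s ; (there (here t≡s′)) → inj₂ t≡s′ }

  project : ∀ {s t} (p : Walk (RAdj R) (just s) (just t)) → nothing ∉ vertices p →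
            Σ (Walk Edge s t) λ P → vertices p ≡ map just (vertices P)
  project []                    _  = [] , refl
  project (_∷_ {w = nothing} _ p) ρ∉ = contradiction (there (RW.first∈ p)) ρ∉
  project {s} (_∷_ {w = just _} e p) ρ∉ with project p (ρ∉ ∘ there)
  ... | P , eq = proj₁ e ∷ P , cong (just s ∷_) eq

  project-unique : ∀ {xs : List (RV R)} {ys : List (Fin m)} → xs ≡ map just ys → Unique xs → Unique ys
  project-unique refl = UniqueProps.map⁻

  project-∈ : ∀ {xs : List (RV R)} {ys : List (Fin m)} {t} → xs ≡ map just ys → t ∈ ys → just t ∈ xs
  project-∈ refl = ∈-map⁺ just

  no-root-edge : ∀ {a b e rest} → IsRootEdge a b → (p : Walk (RAdj R) (just a) e) →
                 vertices p ≡ just a ∷ just b ∷ rest → ⊥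
  no-root-edge ab p eq = proj₂ (RW.first-edge p eq) ab

  ends-apart : ∀ {a b y} → IsRootEdge a b →
               (p : Walk (RAdj R) (just a) (just y)) (q : Walk (RAdj R) (just b) (just y)) →
               Unique (vertices p) → Unique (vertices q) → nothing ∉ vertices p → nothing ∉ vertices q → ⊥
  ends-apart ab p q up uq ρ∉p ρ∉q with project p ρ∉p | project q ρ∉q
  ... | P , eqP | Q , eqQ
    with edge-side (root-edge ab) P Q (project-unique eqP up) (project-unique eqQ uq)
  ... | inj₁ (rest , vP) = no-root-edge ab p (trans eqP (cong (map just) vP))
  ... | inj₂ (rest , vQ) = no-root-edge (root-edge-sym ab) q (trans eqQ (cong (map just) vQ))

  root-paths-agree : ∀ {y} (p q : RootPath y) → Unique (vertices p) → Unique (vertices q) →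
                     vertices p ≡ vertices q
  root-paths-agree []      []      _  _  = refl
  root-paths-agree []      (_ ∷ q) _  uq = contradiction (RW.last∈ q) (Unique[x∷xs]⇒x∉xs uq)
  root-paths-agree (_ ∷ p) []      up _  = contradiction (RW.last∈ p) (Unique[x∷xs]⇒x∉xs up)
  root-paths-agree (_∷_ {w = nothing} () _) _ _ _
  root-paths-agree (_∷_ {w = just _} _ _) (_∷_ {w = nothing} () _) _ _
  root-paths-agree {nothing} (_∷_ {w = just _} _ p) (_∷_ {w = just _} _ _) up _ =
    contradiction (RW.last∈ p) (Unique[x∷xs]⇒x∉xs up)
  root-paths-agree {just y} (_∷_ {w = just s} s-child p) (_∷_ {w = just s′} s′-child q) up uq
    with s ≟F s′
  ... | no s≢s′ = ⊥-elim (ends-apart (root-children s-child s′-child s≢s′) p q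
                                     (unique-tail up) (unique-tail uq) (Unique[x∷xs]⇒x∉xs up) (Unique[x∷xs]⇒x∉xs uq))
  ... | yes refl with project p (Unique[x∷xs]⇒x∉xs up) | project q (Unique[x∷xs]⇒x∉xs uq)
  ...   | P , eqP | Q , eqQ = cong (nothing ∷_) (begin
          vertices p             ≡⟨ eqP ⟩
          map just (vertices P)  ≡⟨ cong (map just) (paths-agree P Q (project-unique eqP (unique-tail up))
                                                                     (project-unique eqQ (unique-tail uq))) ⟩
          map just (vertices Q)  ≡⟨ sym eqQ ⟩
          vertices q             ∎)
    where open ≡-Reasoning

  ancestor-on-path : ∀ {x y} → Anc R x y → (p : RootPath y) → Unique (vertices p) → x ∈ vertices p
  ancestor-on-path ((q , uq) , x∈q) p up = subst (_ ∈_) (root-paths-agree q p uq up) x∈q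

  ancestor-trans : ∀ {x y z} → Anc R x y → Anc R y z → Anc R x z
  ancestor-trans x≼y ((pz , upz) , y∈pz) =
    (pz , upz) , RS.before-⊆ S upz (ancestor-on-path x≼y before (RS.before-unique S upz))
    where
      S = RS.split pz _ y∈pz
      open RS.Split S

  ancestor-antisym : ∀ {x y} → Anc R x y → Anc R y x → x ≡ y
  ancestor-antisym {x} {y} ((py , upy) , x∈py) y≼x =
    on-path-to-x (∈-++⁻ pre (subst (_ ∈_) vertices-before (ancestor-on-path y≼x before (RS.before-unique S upy))))
    where
      S = RS.split py x x∈py
      open RS.Split S
      -- y cannot occur before x, since the path continues from x to y
      on-path-to-x : y ∈ pre ⊎ y ∈ x ∷ [] → x ≡ y
      on-path-to-x (inj₁ y∈pre)      = contradiction (RW.last∈ after) (unique-disjoint pre (subst Unique vertices-split upy) y∈pre)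
      on-path-to-x (inj₂ (here y≡x)) = sym y≡x

  root-first : ∀ {y h e} (p : RootPath y) pre (q : Walk (RAdj R) (just h) e) →
               vertices p ≡ pre ++ vertices q → nothing ∈ pre
  root-first p []      q eq with RW.same-start p q eq
  ... | ()
  root-first p (_ ∷ _) q eq = here (∷-injectiveˡ (trans (sym (proj₂ (RW.vertices-start p))) eq))

  next-through : ∀ {y z x} (p : RootPath y) → Unique (vertices p) → z ∈ vertices p →
                 (pz : RootPath z) → Unique (vertices pz) → x ∈ vertices pz → x ≢ z →
                 next x (vertices p) ≡ next x (vertices pz)
  next-through {z = z} {x} p up z∈p pz upz x∈pz x≢z = begin
    next x (vertices p)                ≡⟨ cong (next x) (trans vertices-split (cong (pre ++_) after-eq)) ⟩
    next x (pre ++ z ∷ rest)           ≡⟨ next-prefix x pre z rest [] (x-before-z (∈-++⁻ pre x∈before)) ⟩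
    next x (pre ∷ʳ z)                  ≡⟨ cong (next x) (sym pz≡before) ⟩
    next x (vertices pz)               ∎
    where
      open ≡-Reasoning
      S = RS.split p z z∈p
      open RS.Split S
      rest = proj₁ (RW.vertices-start after)
      after-eq = proj₂ (RW.vertices-start after)
      pz≡before : vertices pz ≡ pre ∷ʳ z
      pz≡before = trans (root-paths-agree pz before upz (RS.before-unique S up)) vertices-before
      x∈before : x ∈ pre ∷ʳ z
      x∈before = subst (x ∈_) pz≡before x∈pz
      x-before-z : x ∈ pre ⊎ x ∈ z ∷ [] → x ∈ pre
      x-before-z (inj₁ x∈pre)      = x∈pre
      x-before-z (inj₂ (here x≡z)) = contradiction x≡z x≢z

  next-on-branch : ∀ {h x a} (p : RootPath (just a)) → Unique (vertices p) → just h ∈ vertices p →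
                   Branch h x a → next (just h) (vertices p) ≡ just (just x)
  next-on-branch {h} {x} p up h∈p B =
    trans (cong (next (just h)) p≡) (next-first (just h) pre (just x) (map just rest) t∉pre)
    where
      S = RS.split p (just h) h∈p
      open RS.Split S
      simple-p = subst Unique vertices-split up
      ρ∉after = unique-disjoint pre simple-p (root-first p pre after vertices-split)
      P = proj₁ (project after ρ∉after)
      after≡P = proj₂ (project after ρ∉after)
      rest = proj₁ (vertices-start (Branch.rest B))
      P≡branch : vertices P ≡ h ∷ x ∷ rest
      P≡branch = trans (paths-agree P (Branch.path B) (project-unique after≡P (unique-++ʳ pre simple-p)) (Branch.simple B))
                       (cong (h ∷_) (proj₂ (vertices-start (Branch.rest B))))
      p≡ : vertices p ≡ pre ++ just h ∷ just x ∷ map just rest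
      p≡ = trans vertices-split (cong (pre ++_) (trans after≡P (cong (map just) P≡branch)))

  parent-on-path : ∀ {c h} → deg c ≡ 1 → Edge c h → c ≢ u → c ≢ v →
                   (pc : RootPath (just c)) → just h ∈ vertices pc
  parent-on-path {c} {h} dc ch c≢u c≢v pc with RW.last-edge pc (λ ())
  ... | nothing , inj₁ c≡u , _ = contradiction c≡u c≢u
  ... | nothing , inj₂ c≡v , _ = contradiction c≡v c≢v
  ... | just t  , tc , t∈    = subst (λ s → just s ∈ vertices pc) (leaf-neighbour-unique dc (edge-sym (proj₁ tc)) ch) t∈

  walk-avoiding : ∀ {h a b} (pa : RootPath (just a)) (pb : RootPath (just b)) →
                  Unique (vertices pa) → Unique (vertices pb) → just h ∉ vertices pa → just h ∉ vertices pb →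
                  Σ (Walk Edge a b) λ w → h ∉ vertices w
  walk-avoiding (_∷_ {w = nothing} () _) _ _ _ _ _
  walk-avoiding (_∷_ {w = just _} _ _) (_∷_ {w = nothing} () _) _ _ _ _
  walk-avoiding {h} (_∷_ {w = just s} s-child pa) (_∷_ {w = just s′} s′-child pb) upa upb h∉pa h∉pb
    with project pa (Unique[x∷xs]⇒x∉xs upa) | project pb (Unique[x∷xs]⇒x∉xs upb)
       | root-bridge s-child s′-child
  ... | Pa , eqa | Pb , eqb | C , C⊆ = reverseᵂ Pa ++ᵂ C ++ᵂ Pb , avoids
    where
      h∉Pa : h ∉ vertices Pa
      h∉Pa = h∉pa ∘ there ∘ project-∈ eqa
      h∉Pb : h ∉ vertices Pb
      h∉Pb = h∉pb ∘ there ∘ project-∈ eqb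
      h∉C : h ∉ vertices C
      h∉C h∈C with C⊆ h∈C
      ... | inj₁ refl = h∉Pa (first∈ Pa)
      ... | inj₂ refl = h∉Pb (first∈ Pb)
      avoids : h ∉ vertices (reverseᵂ Pa ++ᵂ C ++ᵂ Pb)
      avoids h∈ with ∈-++ᵂ (reverseᵂ Pa) _ h∈
      ... | inj₁ h∈Pa = h∉Pa (∈-reverseᵂ Pa h∈Pa)
      ... | inj₂ h∈   with ∈-++ᵂ C Pb h∈
      ...   | inj₁ h∈C  = h∉C h∈C
      ...   | inj₂ h∈Pb = h∉Pb h∈Pb

  -- Suppose h is an ancestor of a and c and the branches from h to a and b leave h through
  -- different neighbours.  Then lca(a, c) is not a proper ancestor of a common ancestor z of a, b:
  -- otherwise h would lie strictly above z, and the root paths to a and b would leave h alike.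
  branch-point : ∀ {h x y a b c w z} → Branch h x a → Branch h y b → x ≢ y →
                 Anc R (just h) (just a) → Anc R (just h) (just c) →
                 (∀ t → Anc R t (just a) → Anc R t (just c) → Anc R t w) →
                 Anc R z (just a) → Anc R z (just b) → ProperAnc R w z → ⊥
  branch-point {h} {z = z} A B x≢y h≼a h≼c lca-ac z≼a@((pa , upa) , z∈pa) z≼b@((pb , upb) , z∈pb) (w≼z , w≢z) =
    x≢y (just-injective (just-injective (begin
      just (just _)              ≡⟨ sym (next-on-branch pa upa (ancestor-on-path h≼a pa upa) A) ⟩
      next (just h) (vertices pa) ≡⟨ next-through pa upa z∈pa pz upz h∈pz h≢z ⟩
      next (just h) (vertices pz) ≡⟨ sym (next-through pb upb z∈pb pz upz h∈pz h≢z) ⟩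
      next (just h) (vertices pb) ≡⟨ next-on-branch pb upb (ancestor-on-path h≼b pb upb) B ⟩
      just (just _)              ∎)))
    where
      open ≡-Reasoning
      h≼w = lca-ac (just h) h≼a h≼c
      h≼z = ancestor-trans h≼w w≼z
      h≼b = ancestor-trans h≼z z≼b
      h≢z : just h ≢ z
      h≢z refl = w≢z (ancestor-antisym w≼z h≼w)
      pz = proj₁ (proj₁ h≼z)
      upz = proj₂ (proj₁ h≼z)
      h∈pz = proj₂ h≼z

  not-displayed : ∀ {h x y a b c} → Branch h x (leaf a) → Branch h y (leaf b) → x ≢ y →
                  deg (leaf c) ≡ 1 → Edge (leaf c) h → leaf c ≢ u → leaf c ≢ v → ¬ Displays R a b c
  not-displayed {h} A B x≢y dc ch c≢u c≢v
      (w , z , (_ , w≼c , lca-ac) , (_ , _ , lca-bc) , (z≼a@((pa , upa) , _) , z≼b@((pb , upb) , _) , _) , w<z)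
    with just h RS.∈? vertices pa | just h RS.∈? vertices pb
  ... | yes h∈pa | _ = branch-point A B x≢y ((pa , upa) , h∈pa) h≼c lca-ac z≼a z≼b w<z
    where h≼c = proj₁ w≼c , parent-on-path dc ch c≢u c≢v (proj₁ (proj₁ w≼c))
  ... | no _ | yes h∈pb = branch-point B A (x≢y ∘ sym) ((pb , upb) , h∈pb) h≼c lca-bc z≼b z≼a w<z
    where h≼c = proj₁ w≼c , parent-on-path dc ch c≢u c≢v (proj₁ (proj₁ w≼c))
  ... | no h∉pa | no h∉pb with walk-avoiding pa pb upa upb h∉pa h∉pb
  ... | W , h∉W = x≢y (branch-unique (branch-from-walk (Branch.first A) (Branch.rest A ++ᵂ W) avoids) B)
    where
      avoids : h ∉ vertices (Branch.rest A ++ᵂ W)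
      avoids h∈ with ∈-++ᵂ (Branch.rest A) W h∈
      ... | inj₁ h∈A = Unique[x∷xs]⇒x∉xs (Branch.simple A) h∈A
      ... | inj₂ h∈W = h∉W h∈W

-- k² < n + 6 with n ≥ 4 forces k < n, since n ≤ k would give n + 6 ≤ 4n ≤ n² ≤ k²
square-bound : ∀ n k → 4 ≤ n → k * k < n + 6 → k < n
square-bound n k 4≤n k²<n+6 with n ≤? k
... | no n≰k  = ≰⇒> n≰k
... | yes n≤k = contradiction (begin
      n + 6     ≤⟨ +-monoʳ-≤ n (≤-trans (m≤m+n 6 6) (*-monoʳ-≤ 3 4≤n)) ⟩
      4 * n     ≤⟨ *-monoˡ-≤ n 4≤n ⟩
      n * n     ≤⟨ *-mono-≤ n≤k n≤k ⟩
      k * k     ∎) (<⇒≱ k²<n+6)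
  where
    open ≤-Reasoning

unmatched : ∀ {k n} (P : Fin k → Fin n → Set) → (∀ i c → Dec (P i c)) →
            (∀ {i c c′} → P i c → P i c′ → c ≡ c′) → k < n → ∃ λ c → ∀ i → ¬ P i c
unmatched P P? functional k<n with any? (λ c → all? (λ i → ¬? (P? i c)))
... | yes found = found
... | no none =
  let c , c′ , c<c′ , same-index = pigeonhole k<n (proj₁ ∘ match)
  in  contradiction (functional (proj₂ (match c)) (subst (λ i → P i c′) (sym same-index) (proj₂ (match c′))))
                    (<⇒≢F c<c′)
  where
    match : ∀ c → ∃ λ i → P i c
    match c with any? (λ i → P? i c)
    ... | yes matched = matched
    ... | no  c-free  = ⊥-elim (none (c , λ i Pic → c-free (i , Pic)))

module UndisplayedTriplet {n : ℕ} (T' : UTree (suc (suc (suc n)))) where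
  open UTree T'
  open Trees T'
  open DecidableLists (_≟F_ {m}) using (avoid-two)

  leaves-not-adjacent : ∀ {a b} → deg a ≡ 1 → deg b ≡ 1 → ¬ Edge a b
  leaves-not-adjacent {a} {b} da db ab with avoid-two {leaf fz} {leaf (fs fz)} {leaf (fs (fs fz))}
                                                     ((λ ()) ∘ leaf-inj) ((λ ()) ∘ leaf-inj) ((λ ()) ∘ leaf-inj) a b
  ... | ℓ , ℓ≢a , ℓ≢b = adjacent-leaves da db ab ℓ≢a ℓ≢b

  Touches : Rooting T' → Fin (suc (suc (suc n))) → Set
  Touches R c = Rooting.u R ≡ leaf c ⊎ Rooting.v R ≡ leaf c

  touches? : ∀ R c → Dec (Touches R c)
  touches? R c = (Rooting.u R ≟F leaf c) ⊎-dec (Rooting.v R ≟F leaf c)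

  touches-functional : ∀ {R c c′} → Touches R c → Touches R c′ → c ≡ c′
  touches-functional         (inj₁ u≡c) (inj₁ u≡c′) = leaf-inj (trans (sym u≡c) u≡c′)
  touches-functional         (inj₂ v≡c) (inj₂ v≡c′) = leaf-inj (trans (sym v≡c) v≡c′)
  touches-functional {R} {c} {c′} (inj₁ u≡c) (inj₂ v≡c′) =
    ⊥-elim (leaves-not-adjacent (leaf-deg c) (leaf-deg c′) (subst₂ Edge u≡c v≡c′ (Rooting.uv R)))
  touches-functional {R} {c} {c′} (inj₂ v≡c) (inj₁ u≡c′) =
    ⊥-elim (leaves-not-adjacent (leaf-deg c) (leaf-deg c′) (subst₂ Edge v≡c u≡c′ (edge-sym (Rooting.uv R))))

  -- with fewer rootings than leaves, take a leaf c touched by no rooting, its neighbour h,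
  -- the other two neighbours x, y of h and leaves a, b beyond x and y
  undisplayed-triplet : ∀ {k} → k < suc (suc (suc n)) → (Ts : Fin k → Rooting T') →
                        Σ[ a ∈ Fin _ ] Σ[ b ∈ Fin _ ] Σ[ c ∈ Fin _ ]
                          (a ≢ b × a ≢ c × b ≢ c × (∀ i → ¬ Displays (Ts i) a b c))
  undisplayed-triplet k<n Ts with unmatched (Touches ∘ Ts) (touches? ∘ Ts) (λ {i} → touches-functional {Ts i}) k<n
  ... | c , untouched with leaf-neighbour (leaf-deg c)
  ... | h , ch with deg-1-or-3 h
  ... | inj₁ h-leaf = ⊥-elim (leaves-not-adjacent (leaf-deg c) h-leaf ch)
  ... | inj₂ h-internal with two-other-neighbours h-internal (leaf c)
  ... | x , y , hx , hy , x≢y , x≢c , y≢c with leaf-beyond hx | leaf-beyond hy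
  ... | a , A | b , B =
    a , b , c , a≢b , a≢c , b≢c ,
    λ i → RootedTrees.not-displayed (Ts i) A B x≢y (leaf-deg c) ch (untouched i ∘ inj₁ ∘ sym) (untouched i ∘ inj₂ ∘ sym)
    where
      pendant : Branch h (leaf c) (leaf c)
      pendant = record { first = edge-sym ch ; rest = [] ; simple = edge-unique (edge-sym ch) }
      a≢b : a ≢ b
      a≢b refl = x≢y (branch-unique A B)
      a≢c : a ≢ c
      a≢c refl = x≢c (branch-unique A pendant)
      b≢c : b ≢ c
      b≢c refl = y≢c (branch-unique B pendant)

lemma19 : (n : ℕ) → 4 ≤ n → (T' : UTree n) → (k : ℕ) → (Ts : Fin k → Rooting T') →
              k * k < n + 6 →
              Σ[ a ∈ Fin n ] Σ[ b ∈ Fin n ] Σ[ c ∈ Fin n ]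
                (a ≢ b × a ≢ c × b ≢ c × (∀ i → ¬ Displays (Ts i) a b c))
lemma19 n 4≤n@(s≤s (s≤s (s≤s _))) T' k Ts k²<n+6 =
  UndisplayedTriplet.undisplayed-triplet T' (square-bound n k 4≤n k²<n+6) Ts
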